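{- If $A$ is a good $\lambda\alpha$-term which is a normal form for the rewriting system $\sigma\cup\{\alpha\}$ (no rule of $\sigma$ and no $\alpha$-step applies to any subterm of $A$), then $A$ is a usual lambda-term, i.e. $A$ contains no subterm of the form $S\circ B$ (it is built from variables by application and abstraction only).
   Context: Variables $x,y,z,\ldots$; $\mathsf{x},\mathsf{y},\mathsf{z}$ range over variables. Terms and substitutions of $\lambda\alpha$: $A,B::=\mathsf{x}\mid AB\mid\lambda\mathsf{x}.A\mid S\circ A$, $S::=[B/\mathsf{x}]\mid W\mathsf{x}\mid\{\mathsf{y}\mathsf{x}\}\mid S_{\mathsf{x}}$; $S_1\circ S_2\circ A$ means $S_1\circ(S_2\circ A)$, $S\circ AB$ means $S\circ(AB)$, $\lambda\mathsf{x}.S\circ A$ means $\lambda\mathsf{x}.(S\circ A)$. A context $\Gamma$ is a pair $G,L$ of a finite set $G$ of variables and a finite list $L$ of variables with repetitions allowed; $\mathsf{x}\in\Gamma$ means $\mathsf{x}\in G$ or $\mathsf{x}$ occurs in $L$; $\Gamma,\mathsf{x}$ denotes $G,(L,\mathsf{x})$; a context with empty list is written $G$. Derivable judgements: $G\vdash\mathsf{x}$ if $\mathsf{x}\in G$; $\Gamma,\mathsf{x}\vdash\mathsf{x}$; from $\Gamma\vdash\mathsf{x}$ infer $\Gamma,\mathsf{y}\vdash\mathsf{x}$ ($\mathsf{x}\neq\mathsf{y}$); from $\Gamma\vdash A$, $\Gamma\vdash B$ infer $\Gamma\vdash AB$; from $\Gamma,\mathsf{x}\vdash A$ infer $\Gamma\vdash\lambda\mathsf{x}.A$;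 from $\Gamma\vdash S\triangleright\Delta$, $\Delta\vdash A$ infer $\Gamma\vdash S\circ A$; from $\Gamma\vdash B$ infer $\Gamma\vdash[B/\mathsf{x}]\triangleright\Gamma,\mathsf{x}$; $\Gamma,\mathsf{x}\vdash W\mathsf{x}\triangleright\Gamma$; $\Gamma,\mathsf{y}\vdash\{\mathsf{y}\mathsf{x}\}\triangleright\Gamma,\mathsf{x}$; from $\Gamma\vdash S\triangleright\Delta$ infer $\Gamma,\mathsf{x}\vdash S_{\mathsf{x}}\triangleright\Delta,\mathsf{x}$. A term $A$ is good if $G\vdash A$ is derivable for some finite set $G$ (empty local part). Free variables (partial): $FV(\mathsf{x})=\{\mathsf{x}\}$; $FV(AB)=FV(A)\sqcup FV(B)$; $FV(\lambda\mathsf{x}.A)=O_{\lambda\mathsf{x}}(FV(A))$; $FV(W\mathsf{x}\circ A)=FV(A),\mathsf{x}$; $FV([B/\mathsf{x}]\circ A)=FV((\lambda\mathsf{x}.A)B)$; $FV(\{\mathsf{y}\mathsf{x}\}\circ A)=FV(W\mathsf{y}\circ\lambda\mathsf{x}.A)$; $FV(S_{\mathsf{x}}\circ A)=FV(W\mathsf{x}\circ S\circ\lambda\mathsf{x}.A)$; where $O_{\lambda\mathsf{x}}(\Gamma,\mathsf{x})=\Gamma$, $O_{\lambda\mathsf{x}}(G)=G\setminus\{\mathsf{x}\}$, otherwise undefined; $(\Gamma,\mathsf{x})\sqcup(\Delta,\mathsf{x})=(\Gamma\sqcup\Delta),\mathsf{x}$, $(\Gamma,\mathsf{x})\sqcup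 G=(\Gamma\sqcup(G\setminus\{\mathsf{x}\})),\mathsf{x}$, $G\sqcup(\Gamma,\mathsf{x})=((G\setminus\{\mathsf{x}\})\sqcup\Gamma),\mathsf{x}$, $G_1\sqcup G_2=G_1\cup G_2$, otherwise undefined. The system $\sigma$ consists of the rules (applicable in any subterm position): $S\circ AB\to(S\circ A)(S\circ B)$; $S\circ\lambda\mathsf{x}.A\to\lambda\mathsf{x}.S_{\mathsf{x}}\circ A$; $[B/\mathsf{x}]\circ\mathsf{x}\to B$; $[B/\mathsf{x}]\circ W\mathsf{x}\circ A\to A$; $[B/\mathsf{x}]\circ\mathsf{z}\to\mathsf{z}$ ($\mathsf{x}\neq\mathsf{z}$); $\{\mathsf{y}\mathsf{x}\}\circ\mathsf{x}\to\mathsf{y}$; $\{\mathsf{y}\mathsf{x}\}\circ W\mathsf{x}\circ A\to W\mathsf{y}\circ A$; $\{\mathsf{y}\mathsf{x}\}\circ\mathsf{z}\to W\mathsf{y}\circ\mathsf{z}$ ($\mathsf{x}\neq\mathsf{z}$); $S_{\mathsf{x}}\circ\mathsf{x}\to\mathsf{x}$; $S_{\mathsf{x}}\circ W\mathsf{x}\circ A\to W\mathsf{x}\circ S\circ A$; $S_{\mathsf{x}}\circ\mathsf{z}\to W\mathsf{x}\circ S\circ\mathsf{z}$ ($\mathsf{x}\neq\mathsf{z}$); $W\mathsf{x}\circ\mathsf{z}\to\mathsf{z}$ ($\mathsf{x}\neq\mathsf{z}$). The rule $\alpha$ is $\lambda\mathsf{x}.A\to\lambda\mathsf{y}.\{\mathsf{y}\mathsf{x}\}\circ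 A$, applicable when $FV(\lambda\mathsf{x}.A)$ is defined, $\mathsf{x}\in FV(\lambda\mathsf{x}.A)$ and $\mathsf{y}\notin FV(\lambda\mathsf{x}.A)$. -}

module Defs where

open import Data.Nat using (ℕ; _≟_)
open import Data.List using (List; []; _∷_; _++_; filter)
open import Data.List.Membership.Propositional using (_∈_)
open import Data.Maybe using (Maybe; just; nothing; _>>=_)
import Data.Maybe as Maybe
open import Data.Product using (∃; _×_; _,_)
open import Data.Sum using (_⊎_)
open import Relation.Nullary using (¬_; yes; no)
open import Relation.Nullary.Decidable using (¬?)
open import Relation.Binary.PropositionalEquality using (_≡_; _≢_)

Var : Set
Var = ℕ

-- Terms and substitutions of λα
--   var x        = x
--   app A B      = A B
--   lam x A      = λx.A
--   sub S A      = S ∘ A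
--   bind B x     = [B/x]
--   wk x         = W x
--   ren y x      = {y x}
--   lift S x     = S_x

mutual
  data Term : Set where
    var : Var → Term
    app : Term → Term → Term
    lam : Var → Term → Term
    sub : Subst → Term → Term

  data Subst : Set where
    bind : Term → Var → Subst
    wk   : Var → Subst
    ren  : Var → Var → Subst
    lift : Subst → Var → Subst

-- Contexts Γ = G , L.  G is a finite set, represented by a list (only
-- membership in it is ever used); L is a list with repetitions, stored
-- in REVERSED order so that  Γ , x  is a cons.

record Ctx : Set where
  constructor _∣_
  field
    glob : List Var
    loc  : List Var
open Ctx public

infixl 5 _,,_
_,,_ : Ctx → Var → Ctx
(G ∣ L) ,, x = G ∣ (x ∷ L)

_∈ᶜ_ : Var → Ctx → Set
x ∈ᶜ Γ = (x ∈ glob Γ) ⊎ (x ∈ loc Γ)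

mutual
  data _⊢_ : Ctx → Term → Set where
    ⊢glob : ∀ {G x} → x ∈ G → (G ∣ []) ⊢ var x
    ⊢last : ∀ {Γ x} → (Γ ,, x) ⊢ var x
    ⊢weak : ∀ {Γ x y} → x ≢ y → Γ ⊢ var x → (Γ ,, y) ⊢ var x
    ⊢app  : ∀ {Γ A B} → Γ ⊢ A → Γ ⊢ B → Γ ⊢ app A B
    ⊢lam  : ∀ {Γ x A} → (Γ ,, x) ⊢ A → Γ ⊢ lam x A
    ⊢sub  : ∀ {Γ Δ S A} → Γ ⊢ S ▷ Δ → Δ ⊢ A → Γ ⊢ sub S A

  data _⊢_▷_ : Ctx → Subst → Ctx → Set where
    ▷bind : ∀ {Γ B x} → Γ ⊢ B → Γ ⊢ bind B x ▷ (Γ ,, x)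
    ▷wk   : ∀ {Γ x} → (Γ ,, x) ⊢ wk x ▷ Γ
    ▷ren  : ∀ {Γ x y} → (Γ ,, y) ⊢ ren y x ▷ (Γ ,, x)
    ▷lift : ∀ {Γ Δ S x} → Γ ⊢ S ▷ Δ → (Γ ,, x) ⊢ lift S x ▷ (Δ ,, x)

Good : Term → Set
Good A = ∃ λ G → (G ∣ []) ⊢ A

remove : Var → List Var → List Var
remove x = filter (λ y → ¬? (y ≟ x))

O : Var → Ctx → Maybe Ctx
O x (G ∣ [])      = just (remove x G ∣ [])
O x (G ∣ (y ∷ L)) with y ≟ x
... | yes _ = just (G ∣ L)
... | no  _ = nothing

join : List Var → List Var → List Var → List Var → Maybe Ctx
join G (x ∷ L) H (y ∷ M) with x ≟ y
... | yes _ = Maybe.map (_,, x) (join G L H M)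
... | no  _ = nothing
join G (x ∷ L) H []      = Maybe.map (_,, x) (join G L (remove x H) [])
join G []      H (x ∷ M) = Maybe.map (_,, x) (join (remove x G) [] H M)
join G []      H []      = just ((G ++ H) ∣ [])

_⊔_ : Ctx → Ctx → Maybe Ctx
(G ∣ L) ⊔ (H ∣ M) = join G L H M

_⊔ᵐ_ : Maybe Ctx → Maybe Ctx → Maybe Ctx
m ⊔ᵐ n = m >>= λ Γ → n >>= λ Δ → Γ ⊔ Δ

mutual
  FV : Term → Maybe Ctx
  FV (var x)   = just ((x ∷ []) ∣ [])
  FV (app A B) = FV A ⊔ᵐ FV B
  FV (lam x A) = FV A >>= O x
  FV (sub S A) = FVsub S (FV A)

  -- FVsub S (FV A) = FV (S ∘ A); the clauses unfold the paper's equations: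
  --   FV([B/x]∘A) = FV((λx.A)B)       = O_x(FV A) ⊔ FV B
  --   FV(W x ∘ A) = FV(A), x
  --   FV({yx}∘A)  = FV(W y ∘ λx.A)    = O_x(FV A), y
  --   FV(S_x ∘ A) = FV(W x ∘ S ∘ λx.A) = FV(S ∘ λx.A), x
  FVsub : Subst → Maybe Ctx → Maybe Ctx
  FVsub (bind B x) m = (m >>= O x) ⊔ᵐ FV B
  FVsub (wk x)     m = Maybe.map (_,, x) m
  FVsub (ren y x)  m = Maybe.map (_,, y) (m >>= O x)
  FVsub (lift S x) m = Maybe.map (_,, x) (FVsub S (m >>= O x))

mutual
  data _⟶_ : Term → Term → Set where
    σ-app    : ∀ {S A B} → sub S (app A B) ⟶ app (sub S A) (sub S B)
    σ-lam    : ∀ {S x A} → sub S (lam x A) ⟶ lam x (sub (lift S x) A)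
    σ-bind-x : ∀ {B x} → sub (bind B x) (var x) ⟶ B
    σ-bind-W : ∀ {B x A} → sub (bind B x) (sub (wk x) A) ⟶ A
    σ-bind-z : ∀ {B x z} → x ≢ z → sub (bind B x) (var z) ⟶ var z
    σ-ren-x  : ∀ {y x} → sub (ren y x) (var x) ⟶ var y
    σ-ren-W  : ∀ {y x A} → sub (ren y x) (sub (wk x) A) ⟶ sub (wk y) A
    σ-ren-z  : ∀ {y x z} → x ≢ z → sub (ren y x) (var z) ⟶ sub (wk y) (var z)
    σ-lift-x : ∀ {S x} → sub (lift S x) (var x) ⟶ var x
    σ-lift-W : ∀ {S x A} → sub (lift S x) (sub (wk x) A) ⟶ sub (wk x) (sub S A)
    σ-lift-z : ∀ {S x z} → x ≢ z → sub (lift S x) (var z) ⟶ sub (wk x) (sub S (var z))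
    σ-wk-z   : ∀ {x z} → x ≢ z → sub (wk x) (var z) ⟶ var z
    α-step   : ∀ {x y A Γ} → FV (lam x A) ≡ just Γ → x ∈ᶜ Γ → ¬ (y ∈ᶜ Γ) →
               lam x A ⟶ lam y (sub (ren y x) A)
    c-appˡ   : ∀ {A A' B} → A ⟶ A' → app A B ⟶ app A' B
    c-appʳ   : ∀ {A B B'} → B ⟶ B' → app A B ⟶ app A B'
    c-lam    : ∀ {x A A'} → A ⟶ A' → lam x A ⟶ lam x A'
    c-subˡ   : ∀ {S S' A} → S ⟶ˢ S' → sub S A ⟶ sub S' A
    c-subʳ   : ∀ {S A A'} → A ⟶ A' → sub S A ⟶ sub S A'

  data _⟶ˢ_ : Subst → Subst → Set where
    c-bind : ∀ {B B' x} → B ⟶ B' → bind B x ⟶ˢ bind B' x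
    c-lift : ∀ {S S' x} → S ⟶ˢ S' → lift S x ⟶ˢ lift S' x

NormalForm : Term → Set
NormalForm A = ∀ A' → ¬ (A ⟶ A')

data Pure : Term → Set where
  pvar : ∀ {x} → Pure (var x)
  papp : ∀ {A B} → Pure A → Pure B → Pure (app A B)
  plam : ∀ {x A} → Pure A → Pure (lam x A)

-- The proof analyses a well-typed normal form A in a context Γ = G₀ ∣ K and
-- establishes a "shape" invariant for it (Shape below):
--   FV A = G ∣ L, where L is an end segment of the local list K of Γ,
--   the outermost variable of L belongs to the global part G, and
--   A is pure as soon as L is empty.
-- Two facts feed the induction.  First, a normal explicit substitution S ∘ B
-- is necessarily a tower W y₁ ∘ … ∘ W yₙ ∘ x with yₙ = x (WkTower), because
-- every other configuration is a σ-redex; such a tower has FV = {x} ∣ y₁…yₙ.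
-- Second, in a normal abstraction λx.A the body cannot have FV = G ∣ x with
-- x ∈ G, since then α would rename x to a fresh variable.  Applications are
-- handled by the combinatorics of ⊔ on local lists that are end segments of a
-- common list.  For a good term the local list of Γ is empty, so L is empty
-- and the invariant says that A is pure.

module Submission where

open import Defs
open import Data.Nat using (suc; _≟_)
open import Data.Nat.Properties using (1+n≰n; ≟-diag)
open import Data.List using (List; []; _∷_; _++_; last)
open import Data.List.Extrema.Nat using (max; xs≤max)
open import Data.List.Membership.Propositional using (_∈_; _∉_)
open import Data.List.Membership.Propositional.Properties using (∈-++⁺ˡ; ∈-++⁺ʳ)
open import Data.List.Relation.Binary.Prefix.Heterogeneous using (Prefix; []; _∷_)
open import Data.List.Relation.Binary.Subset.Propositional using (_⊆_)
import Data.List.Relation.Unary.All as All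
open import Data.List.Relation.Unary.Any using (here)
open import Data.Maybe using (just; _>>=_)
open import Data.Maybe.Properties using (just-injective)
import Data.Maybe as Maybe
open import Data.Product using (∃; _×_; _,_)
open import Data.Sum using (_⊎_; inj₁; inj₂; [_,_])
import Data.Sum as Sum
open import Data.Empty using (⊥-elim)
open import Relation.Nullary using (yes; no)
open import Relation.Binary.PropositionalEquality using (_≡_; refl; sym; trans; cong; cong₂)

-- Local lists are stored reversed, so "L is an end segment of K" is "L is a
-- prefix of the stored list K".
_≼_ : List Var → List Var → Set
L ≼ K = Prefix _≡_ L K

≼[]⇒[] : ∀ {L} → L ≼ [] → L ≡ []
≼[]⇒[] [] = refl

≼-comparable : ∀ {L M K} → L ≼ K → M ≼ K → L ≼ M ⊎ M ≼ L
≼-comparable []         _          = inj₁ []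
≼-comparable (_ ∷ _)    []         = inj₂ []
≼-comparable (refl ∷ p) (refl ∷ q) = Sum.map (refl ∷_) (refl ∷_) (≼-comparable p q)

O-last : ∀ x G L → O x (G ∣ (x ∷ L)) ≡ just (G ∣ L)
O-last x G L rewrite ≟-diag (refl {x = x}) = refl

join-last : ∀ x G L H M →
            join G (x ∷ L) H (x ∷ M) ≡ Maybe.map (_,, x) (join G L H M)
join-last x G L H M rewrite ≟-diag (refl {x = x}) = refl

join-≼ʳ : ∀ {L M} G H → L ≼ M → ∃ λ G' → join G L H M ≡ just (G' ∣ M) × H ⊆ G'
join-≼ʳ {M = []} G H [] = G ++ H , refl , ∈-++⁺ʳ G
join-≼ʳ {M = x ∷ M} G H [] with join-≼ʳ (remove x G) H ([] {bs = M})
... | G' , eq , H⊆G' = G' , cong (Maybe.map (_,, x)) eq , H⊆G'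
join-≼ʳ {x ∷ L} {.x ∷ M} G H (refl ∷ p) with join-≼ʳ G H p
... | G' , eq , H⊆G' = G' , trans (join-last x G L H M) (cong (Maybe.map (_,, x)) eq) , H⊆G'

join-≼ˡ : ∀ {L M} G H → M ≼ L → ∃ λ G' → join G L H M ≡ just (G' ∣ L) × G ⊆ G'
join-≼ˡ {L = []} G H [] = G ++ H , refl , ∈-++⁺ˡ
join-≼ˡ {L = x ∷ L} G H [] with join-≼ˡ G (remove x H) ([] {bs = L})
... | G' , eq , G⊆G' = G' , cong (Maybe.map (_,, x)) eq , G⊆G'
join-≼ˡ {x ∷ L} {.x ∷ M} G H (refl ∷ p) with join-≼ˡ G H p
... | G' , eq , G⊆G' = G' , trans (join-last x G L H M) (cong (Maybe.map (_,, x)) eq) , G⊆G'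

fresh : List Var → Var
fresh G = suc (max 0 G)

fresh-∉ : ∀ G → fresh G ∉ G
fresh-∉ G p = 1+n≰n (All.lookup (xs≤max 0 G) p)

OuterIn : List Var → List Var → Set
OuterIn G L = ∀ {x} → last L ≡ just x → x ∈ G

record Shape (Γ : Ctx) (A : Term) : Set where
  constructor shape
  field
    G L   : List Var
    fv    : FV A ≡ just (G ∣ L)
    local : L ≼ loc Γ
    outer : OuterIn G L
    pure  : L ≡ [] → Pure A

data WkTower (x : Var) : Term → Set where
  base : WkTower x (sub (wk x) (var x))
  step : ∀ {y A} → WkTower x A → WkTower x (sub (wk y) A)

normal-sub-var : ∀ S z → NormalForm (sub S (var z)) → WkTower z (sub S (var z))
normal-sub-var (bind B x) z nf with x ≟ z
... | yes refl = ⊥-elim (nf _ σ-bind-x)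
... | no x≢z   = ⊥-elim (nf _ (σ-bind-z x≢z))
normal-sub-var (ren y x) z nf with x ≟ z
... | yes refl = ⊥-elim (nf _ σ-ren-x)
... | no x≢z   = ⊥-elim (nf _ (σ-ren-z x≢z))
normal-sub-var (lift S x) z nf with x ≟ z
... | yes refl = ⊥-elim (nf _ σ-lift-x)
... | no x≢z   = ⊥-elim (nf _ (σ-lift-z x≢z))
normal-sub-var (wk x) z nf with x ≟ z
... | yes refl = base
... | no x≢z   = ⊥-elim (nf _ (σ-wk-z x≢z))

-- Typing forces a substitution S placed over W y ∘ B to have a target
-- context ending in y; if S is [B'/y], {z y} or T_y this is a σ-redex.
wk-on-tower : ∀ {Γ Δ Δ' S S' B x} → Γ ⊢ S ▷ Δ → Δ ⊢ S' ▷ Δ' →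
              WkTower x (sub S' B) → NormalForm (sub S (sub S' B)) →
              WkTower x (sub S (sub S' B))
wk-on-tower ▷wk       _   t _  = step t
wk-on-tower (▷bind _) ▷wk _ nf = ⊥-elim (nf _ σ-bind-W)
wk-on-tower ▷ren      ▷wk _ nf = ⊥-elim (nf _ σ-ren-W)
wk-on-tower (▷lift _) ▷wk _ nf = ⊥-elim (nf _ σ-lift-W)

normal-sub⇒tower : ∀ {Γ Δ S B} → Γ ⊢ S ▷ Δ → Δ ⊢ B → NormalForm (sub S B) →
                   ∃ λ x → WkTower x (sub S B)
normal-sub⇒tower {S = S} _ (⊢glob {x = z} _)   nf = z , normal-sub-var S z nf
normal-sub⇒tower {S = S} _ (⊢last {x = z})     nf = z , normal-sub-var S z nf
normal-sub⇒tower {S = S} _ (⊢weak {x = z} _ _) nf = z , normal-sub-var S z nf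
normal-sub⇒tower _ (⊢app _ _) nf = ⊥-elim (nf _ σ-app)
normal-sub⇒tower _ (⊢lam _)   nf = ⊥-elim (nf _ σ-lam)
normal-sub⇒tower d (⊢sub d' e') nf
  with normal-sub⇒tower d' e' (λ B' r → nf _ (c-subʳ r))
... | x , t = x , wk-on-tower d d' t nf

last-∷ : ∀ {x : Var} y (L : List Var) → last L ≡ just x → last (y ∷ L) ≡ just x
last-∷ y (_ ∷ _) eq = eq

tower-fv : ∀ {Γ A x} → Γ ⊢ A → WkTower x A →
           ∃ λ L → FV A ≡ just ((x ∷ []) ∣ L) × L ≼ loc Γ × last L ≡ just x
tower-fv (⊢sub ▷wk _) base = _ , refl , refl ∷ [] , refl
tower-fv (⊢sub (▷wk {x = y}) e) (step t) with tower-fv e t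
... | L , fv , p , lastL = y ∷ L , cong (Maybe.map (_,, y)) fv , refl ∷ p , last-∷ y L lastL

last-outer : ∀ {L : List Var} {x} → last L ≡ just x → OuterIn (x ∷ []) L
last-outer lastL eq = here (just-injective (trans (sym eq) lastL))

last-nonempty : ∀ {L : List Var} {x} {A : Term} → last L ≡ just x → L ≡ [] → Pure A
last-nonempty () refl

sub-shape : ∀ {Γ Δ S B} → Γ ⊢ S ▷ Δ → Δ ⊢ B → NormalForm (sub S B) → Shape Γ (sub S B)
sub-shape d e nf with normal-sub⇒tower d e nf
... | x , t with tower-fv (⊢sub d e) t
... | L , fv , p , lastL = shape (x ∷ []) L fv p (last-outer {L} lastL) (last-nonempty {L} lastL)

var-shape : ∀ {Γ} x → Shape Γ (var x)
var-shape x = shape (x ∷ []) [] refl [] (λ ()) (λ _ → pvar)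

-- Shapes of A and B combine to a shape of AB: the local lists are prefixes
-- of the same list, so ⊔ keeps the longer one together with its outermost
-- variable, and if it is empty then so is the shorter one.
app-shape : ∀ {Γ A B} → Shape Γ A → Shape Γ B → Shape Γ (app A B)
app-shape (shape G₁ L₁ fv₁ p₁ o₁ u₁) (shape G₂ L₂ fv₂ p₂ o₂ u₂)
  with ≼-comparable p₁ p₂
... | inj₁ L₁≼L₂ with join-≼ʳ G₁ G₂ L₁≼L₂
...   | G , eq , G₂⊆G =
  shape G L₂ (trans (cong₂ _⊔ᵐ_ fv₁ fv₂) eq) p₂ (λ e → G₂⊆G (o₂ e))
        (λ { refl → papp (u₁ (≼[]⇒[] L₁≼L₂)) (u₂ refl) })
app-shape (shape G₁ L₁ fv₁ p₁ o₁ u₁) (shape G₂ L₂ fv₂ p₂ o₂ u₂)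
    | inj₂ L₂≼L₁ with join-≼ˡ G₁ G₂ L₂≼L₁
...   | G , eq , G₁⊆G =
  shape G L₁ (trans (cong₂ _⊔ᵐ_ fv₁ fv₂) eq) p₁ (λ e → G₁⊆G (o₁ e))
        (λ { refl → papp (u₁ refl) (u₂ (≼[]⇒[] L₂≼L₁)) })

-- The body of a normal abstraction λx.A has local list ε, or x followed by
-- a non-empty list: a local list consisting of x alone, with x ∈ G, would
-- make λx.A an α-redex.
lam-shape : ∀ {Γ x A} → NormalForm (lam x A) → Shape (Γ ,, x) A → Shape Γ (lam x A)
lam-shape {x = x} nf (shape G [] fv _ _ u) =
  shape (remove x G) [] (cong (_>>= O x) fv) [] (λ ()) (λ _ → plam (u refl))
lam-shape {x = x} nf (shape G (.x ∷ []) fv (refl ∷ _) o _) =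
  ⊥-elim (nf _ (α-step {y = fresh G} (trans (cong (_>>= O x) fv) (O-last x G []))
                       (inj₁ (o refl)) [ fresh-∉ G , (λ ()) ]))
lam-shape {x = x} nf (shape G (.x ∷ z ∷ L) fv (refl ∷ p) o _) =
  shape G (z ∷ L) (trans (cong (_>>= O x) fv) (O-last x G (z ∷ L))) p o (λ ())

normal-shape : ∀ {Γ A} → Γ ⊢ A → NormalForm A → Shape Γ A
normal-shape (⊢glob {x = x} _)   _  = var-shape x
normal-shape (⊢last {x = x})     _  = var-shape x
normal-shape (⊢weak {x = x} _ _) _  = var-shape x
normal-shape (⊢app d e) nf =
  app-shape (normal-shape d (λ _ r → nf _ (c-appˡ r))) (normal-shape e (λ _ r → nf _ (c-appʳ r)))
normal-shape (⊢lam d) nf = lam-shape nf (normal-shape d (λ _ r → nf _ (c-lam r)))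
normal-shape (⊢sub d e) nf = sub-shape d e nf

mainTheorem3 : (A : Term) → Good A → NormalForm A → Pure A
mainTheorem3 A (G , d) nf = Shape.pure s (≼[]⇒[] (Shape.local s))
  where
  s : Shape (G ∣ []) A
  s = normal-shape d nf
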